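{- For all non-negative integers $k,n$, every weak embedding $f$ of $L_2(k)$ into $L_2(n)$ is also a strong embedding, i.e., for all $x,y\in L_2(k)$ we have $f(x)\le f(y)$ if and only if $x\le y$.
   Context: The Boolean lattice $B_m$ is the poset of all subsets of $\{1,\dots,m\}$ ordered by inclusion; its $j$-th level is the set of $j$-element subsets. $L_2(m)$ denotes the subposet of $B_m$ formed by the union of its two middle levels, namely levels $\lfloor (m-1)/2\rfloor$ and $\lfloor (m+1)/2\rfloor$. A weak embedding of a poset $P$ into a poset $Q$ is an injective map $f$ with $p\le q\Rightarrow f(p)\le f(q)$. -}

module Defs where

open import Data.Nat using (ℕ; _∸_; _+_)
open import Data.Nat.DivMod using (_/_)
open import Data.Fin.Subset using (Subset; _⊆_; ∣_∣)
open import Data.Product using (Σ; proj₁; _×_)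
open import Data.Sum using (_⊎_)
open import Relation.Binary.PropositionalEquality using (_≡_)

-- For m = 0 the lower index ⌊-1/2⌋ = -1 is an empty level; truncated
-- subtraction gives 0 instead, which is the upper level anyway, so the
-- resulting set of subsets is the same.
lowMid : ℕ → ℕ
lowMid m = (m ∸ 1) / 2

highMid : ℕ → ℕ
highMid m = (m + 1) / 2

L₂ : ℕ → Set
L₂ m = Σ (Subset m) (λ A → (∣ A ∣ ≡ lowMid m) ⊎ (∣ A ∣ ≡ highMid m))

_≤L_ : ∀ {m} → L₂ m → L₂ m → Set
x ≤L y = proj₁ x ⊆ proj₁ y

InjectiveL : ∀ {k n} → (L₂ k → L₂ n) → Set
InjectiveL f = ∀ x y → proj₁ (f x) ≡ proj₁ (f y) → proj₁ x ≡ proj₁ y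

WeakEmbedding : ∀ {k n} → (L₂ k → L₂ n) → Set
WeakEmbedding f = InjectiveL f × (∀ x y → x ≤L y → f x ≤L f y)

-- An injective monotone map sends each edge x ⊂ x ∪ {j} of L₂(k) to a strict
-- inclusion, hence low sets to the lower and up sets to the upper middle level of
-- L₂(n), which are then adjacent, and F(x ∪ {j}) = F(x) ∪ {e} for a label e.
-- Injectivity forbids the images of a square x, x ∪ {j}, x − p ∪ {j}, x ∪ {q}
-- from collapsing, which forces the edge x − p ∪ {q} ⊂ x − p ∪ {q, j} to carry
-- the same label; since the low sets avoiding j are connected by such swaps,
-- all j-edges share one label. Now let F x ⊆ F y with x low and y up, pick
-- j ∈ y − x and let e label y − j ⊂ y. As e also labels x ⊂ x ∪ {j}, e ∉ F x,
-- so F x ⊆ F y − e = F(y − j) and injectivity gives x = y − j ⊆ y.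

module Submission where

open import Defs
open import Data.Bool using (Bool)
open import Data.Fin using (Fin; zero; suc; _≟_)
open import Data.Fin.Properties using (any?)
open import Data.Fin.Subset
  using (Subset; inside; outside; _∈_; _∉_; _⊆_; _─_; ∣_∣; ⊤; ⊥)
open import Data.Fin.Subset.Properties
  using (_∈?_; ⊆-trans; ⊆-reflexive; ⊆-antisym; p⊆q⇒∣p∣≤∣q∣; p⊂q⇒∣p∣<∣q∣; ∣⊤∣≡n; ∣⊥∣≡0)
open import Data.Nat using (ℕ; zero; suc; _≤_; _<_; s≤s; z≤n)
open import Data.Nat.DivMod using (_/_; m/n≡1+[m∸n]/n; m/n≤m; /-monoˡ-≤)
open import Data.Nat.Induction using (<-wellFounded)
open import Data.Nat.Properties
  using (≤-trans; ≤-reflexive; <-irrefl; <⇒≢; <⇒≱; ≤∧≢⇒<; m+n∸n≡m; m∸n≤m; m≤m+n; m≤n+m; suc-injective)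
open import Data.Product using (∃; _×_; _,_; proj₁; proj₂)
open import Data.Sum using (_⊎_; inj₁; inj₂)
open import Data.Vec.Base using (_∷_; _[_]=_; here; there; _[_]≔_)
open import Data.Vec.Properties
  using ([]=-injective; []=⇒lookup; lookup⇒[]=; []≔-updates; []≔-minimal; []≔-idempotent; []≔-lookup)
open import Function using (_∘_)
open import Induction.WellFounded using (Acc; acc)
open import Relation.Binary.PropositionalEquality
  using (_≡_; _≢_; refl; sym; trans; cong; subst; module ≡-Reasoning)
open import Relation.Nullary using (yes; no; ¬?; contradiction)
open import Relation.Nullary.Decidable using (_×-dec_; decidable-stable)

private
  variable
    n : ℕ
    b : Bool
    i j : Fin n
    p q r : Subset n

highMid-suc : ∀ m → highMid (suc m) ≡ suc (lowMid (suc m))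
highMid-suc m = trans (m/n≡1+[m∸n]/n (s≤s (m≤n+m 1 m))) (cong (λ t → suc (t / 2)) (m+n∸n≡m m 1))

lowMid<suc : ∀ m → lowMid (suc m) < suc m
lowMid<suc m = s≤s (m/n≤m m 2)

lowMid≤highMid : ∀ n → lowMid n ≤ highMid n
lowMid≤highMid n = /-monoˡ-≤ 2 (≤-trans (m∸n≤m n 1) (m≤m+n n 1))

lowMid<highMid⇒gap : ∀ n → lowMid n < highMid n → highMid n ≡ suc (lowMid n)
lowMid<highMid⇒gap zero    lt = contradiction lt (<-irrefl refl)
lowMid<highMid⇒gap (suc n) _  = highMid-suc n

middle-levels-< : ∀ {n s t} →
                  s ≡ lowMid n ⊎ s ≡ highMid n → t ≡ lowMid n ⊎ t ≡ highMid n → s < t →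
                  s ≡ lowMid n × t ≡ highMid n × highMid n ≡ suc (lowMid n)
middle-levels-< (inj₁ refl) (inj₁ refl) s<t = contradiction s<t (<-irrefl refl)
middle-levels-< (inj₂ refl) (inj₂ refl) s<t = contradiction s<t (<-irrefl refl)
middle-levels-< {n} (inj₁ refl) (inj₂ refl) s<t = refl , refl , lowMid<highMid⇒gap n s<t
middle-levels-< {n} (inj₂ refl) (inj₁ refl) s<t = contradiction (lowMid≤highMid n) (<⇒≱ s<t)

∈∧∉⇒≢ : i ∈ p → j ∉ p → i ≢ j
∈∧∉⇒≢ i∈p j∉p refl = j∉p i∈p

∉∧∈⇒≢ : i ∉ p → i ∈ q → p ≢ q
∉∧∈⇒≢ i∉p i∈q refl = i∉p i∈q

[]≔-minimal⁻ : ∀ (p : Subset n) {b c} → i ≢ j → (p [ j ]≔ b) [ i ]= c → p [ i ]= c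
[]≔-minimal⁻ {i = i} {j} p i≢j p′[i]=c =
  subst (p [ i ]=_) ([]=-injective ([]≔-minimal p i j i≢j p[i]) p′[i]=c) p[i]
  where p[i] = lookup⇒[]= i p refl

∈-[]≔ : i ≢ j → i ∈ p → i ∈ p [ j ]≔ b
∈-[]≔ {i = i} {j} {p} i≢j = []≔-minimal p i j i≢j

∉-[]≔ : i ≢ j → i ∉ p → i ∉ p [ j ]≔ b
∉-[]≔ {p = p} i≢j i∉p = i∉p ∘ []≔-minimal⁻ p i≢j

⊆-[]≔inside : p ⊆ p [ i ]≔ inside
⊆-[]≔inside {p = p} {i} {j} j∈p with j ≟ i
... | yes refl = []≔-updates p j
... | no j≢i   = ∈-[]≔ j≢i j∈p

i∉p[i]≔outside : i ∉ p [ i ]≔ outside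
i∉p[i]≔outside {i = i} {p} i∈p′ = contradiction ([]=-injective ([]≔-updates p i) i∈p′) λ ()

[]≔outside-⊆ : p [ i ]≔ outside ⊆ p
[]≔outside-⊆ {p = p} {i} {j} j∈p′ with j ≟ i
... | yes refl = contradiction j∈p′ i∉p[i]≔outside
... | no j≢i   = []≔-minimal⁻ p j≢i j∈p′

[]≔-mono : p ⊆ q → p [ i ]≔ b ⊆ q [ i ]≔ b
[]≔-mono {p = p} {q} {i} {b} p⊆q {j} j∈p′ with j ≟ i
... | yes refl = subst (q [ j ]≔ b [ j ]=_) ([]=-injective ([]≔-updates p j) j∈p′) ([]≔-updates q j)
... | no j≢i   = ∈-[]≔ j≢i (p⊆q ([]≔-minimal⁻ p j≢i j∈p′))

⊆-[]≔inside⁻ : r ⊆ p [ i ]≔ inside → i ∉ r → r ⊆ p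
⊆-[]≔inside⁻ {p = p} r⊆p′ i∉r j∈r = []≔-minimal⁻ p (λ { refl → i∉r j∈r }) (r⊆p′ j∈r)

[]≔inside-⊆ : p ⊆ r → i ∈ r → p [ i ]≔ inside ⊆ r
[]≔inside-⊆ {p = p} {i = i} p⊆r i∈r {j} j∈p′ with j ≟ i
... | yes refl = i∈r
... | no j≢i   = p⊆r ([]≔-minimal⁻ p j≢i j∈p′)

[]≔outside-[]≔inside : i ∈ p → p [ i ]≔ outside [ i ]≔ inside ≡ p
[]≔outside-[]≔inside {i = i} {p} i∈p = begin
  p [ i ]≔ outside [ i ]≔ inside ≡⟨ []≔-idempotent p i ⟩
  p [ i ]≔ inside                ≡⟨ cong (p [ i ]≔_) ([]=⇒lookup i∈p) ⟨
  p [ i ]≔ _                     ≡⟨ []≔-lookup p i ⟩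
  p                              ∎
  where open ≡-Reasoning

⊆⊎∃∈∉ : (p q : Subset n) → p ⊆ q ⊎ ∃ λ i → i ∈ p × i ∉ q
⊆⊎∃∈∉ p q with any? (λ i → i ∈? p ×-dec ¬? (i ∈? q))
... | yes witness = inj₂ witness
... | no ∄        = inj₁ λ {i} i∈p → decidable-stable (i ∈? q) (λ i∉q → ∄ (i , i∈p , i∉q))

p⊆q∧∣p∣≡∣q∣⇒p≡q : p ⊆ q → ∣ p ∣ ≡ ∣ q ∣ → p ≡ q
p⊆q∧∣p∣≡∣q∣⇒p≡q {p = p} {q} p⊆q ∣p∣≡∣q∣ with ⊆⊎∃∈∉ q p
... | inj₁ q⊆p   = ⊆-antisym p⊆q q⊆p
... | inj₂ extra = contradiction ∣p∣≡∣q∣ (<⇒≢ (p⊂q⇒∣p∣<∣q∣ (p⊆q , extra)))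

p⊆q∧p≢q⇒∣p∣<∣q∣ : p ⊆ q → p ≢ q → ∣ p ∣ < ∣ q ∣
p⊆q∧p≢q⇒∣p∣<∣q∣ p⊆q p≢q = ≤∧≢⇒< (p⊆q⇒∣p∣≤∣q∣ p⊆q) (p≢q ∘ p⊆q∧∣p∣≡∣q∣⇒p≡q p⊆q)

∣p∣<∣q∣⇒∃∈∉ : ∣ p ∣ < ∣ q ∣ → ∃ λ i → i ∈ q × i ∉ p
∣p∣<∣q∣⇒∃∈∉ {p = p} {q} ∣p∣<∣q∣ with ⊆⊎∃∈∉ q p
... | inj₁ q⊆p   = contradiction (p⊆q⇒∣p∣≤∣q∣ q⊆p) (<⇒≱ ∣p∣<∣q∣)
... | inj₂ extra = extra

∣p∣<n⇒∃∉ : ∀ {n} {p : Subset n} → ∣ p ∣ < n → ∃ λ i → i ∉ p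
∣p∣<n⇒∃∉ {n} {p} ∣p∣<n with ∣p∣<∣q∣⇒∃∈∉ {q = ⊤} (subst (∣ p ∣ <_) (sym (∣⊤∣≡n n)) ∣p∣<n)
... | i , _ , i∉p = i , i∉p

0<∣p∣⇒∃∈ : ∀ {n} {p : Subset n} → 0 < ∣ p ∣ → ∃ λ i → i ∈ p
0<∣p∣⇒∃∈ {n} {p} 0<∣p∣ with ∣p∣<∣q∣⇒∃∈∉ {p = ⊥} (subst (_< ∣ p ∣) (sym (∣⊥∣≡0 n)) 0<∣p∣)
... | i , i∈p , _ = i , i∈p

∣p[i]≔inside∣ : i ∉ p → ∣ p [ i ]≔ inside ∣ ≡ suc ∣ p ∣
∣p[i]≔inside∣ {i = zero}  {p = inside  ∷ p} i∉p = contradiction here i∉p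
∣p[i]≔inside∣ {i = zero}  {p = outside ∷ p} _   = refl
∣p[i]≔inside∣ {i = suc i} {p = inside  ∷ p} i∉p = cong suc (∣p[i]≔inside∣ (i∉p ∘ there))
∣p[i]≔inside∣ {i = suc i} {p = outside ∷ p} i∉p = ∣p[i]≔inside∣ (i∉p ∘ there)

∣p[i]≔outside∣ : i ∈ p → suc ∣ p [ i ]≔ outside ∣ ≡ ∣ p ∣
∣p[i]≔outside∣ {i = zero}  {p = inside  ∷ p} here        = refl
∣p[i]≔outside∣ {i = suc i} {p = inside  ∷ p} (there i∈p) = cong suc (∣p[i]≔outside∣ i∈p)
∣p[i]≔outside∣ {i = suc i} {p = outside ∷ p} (there i∈p) = ∣p[i]≔outside∣ i∈p

∣p[i]≔outside[j]≔inside∣ : i ∈ p → j ∉ p → ∣ p [ i ]≔ outside [ j ]≔ inside ∣ ≡ ∣ p ∣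
∣p[i]≔outside[j]≔inside∣ i∈p j∉p =
  trans (∣p[i]≔inside∣ (∉-[]≔ (∈∧∉⇒≢ i∈p j∉p ∘ sym) j∉p)) (∣p[i]≔outside∣ i∈p)

∣p[i]≔outside─q∣ : i ∈ p → i ∉ q → suc ∣ p [ i ]≔ outside ─ q ∣ ≡ ∣ p ─ q ∣
∣p[i]≔outside─q∣ {i = zero}  {p = inside  ∷ p} {q = outside ∷ q} here        _   = refl
∣p[i]≔outside─q∣ {i = zero}  {p = inside  ∷ p} {q = inside  ∷ q} here        i∉q = contradiction here i∉q
∣p[i]≔outside─q∣ {i = suc i} {p = _       ∷ p} {q = inside  ∷ q} (there i∈p) i∉q =
  ∣p[i]≔outside─q∣ i∈p (i∉q ∘ there)
∣p[i]≔outside─q∣ {i = suc i} {p = inside  ∷ p} {q = outside ∷ q} (there i∈p) i∉q =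
  cong suc (∣p[i]≔outside─q∣ i∈p (i∉q ∘ there))
∣p[i]≔outside─q∣ {i = suc i} {p = outside ∷ p} {q = outside ∷ q} (there i∈p) i∉q =
  ∣p[i]≔outside─q∣ i∈p (i∉q ∘ there)

∣p[i]≔inside─q∣ : i ∈ q → ∣ p [ i ]≔ inside ─ q ∣ ≡ ∣ p ─ q ∣
∣p[i]≔inside─q∣ {i = zero}  {q = inside  ∷ q} {p = _       ∷ p} here        = refl
∣p[i]≔inside─q∣ {i = suc i} {q = inside  ∷ q} {p = _       ∷ p} (there i∈q) =
  ∣p[i]≔inside─q∣ {p = p} i∈q
∣p[i]≔inside─q∣ {i = suc i} {q = outside ∷ q} {p = inside  ∷ p} (there i∈q) =
  cong suc (∣p[i]≔inside─q∣ {p = p} i∈q)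
∣p[i]≔inside─q∣ {i = suc i} {q = outside ∷ q} {p = outside ∷ p} (there i∈q) =
  ∣p[i]≔inside─q∣ {p = p} i∈q

cover⇒[]≔inside : p ⊆ q → ∣ q ∣ ≡ suc ∣ p ∣ → i ∉ p → i ∈ q → q ≡ p [ i ]≔ inside
cover⇒[]≔inside p⊆q ∣q∣≡ i∉p i∈q =
  sym (p⊆q∧∣p∣≡∣q∣⇒p≡q ([]≔inside-⊆ p⊆q i∈q) (trans (∣p[i]≔inside∣ i∉p) (sym ∣q∣≡)))

module _ {m n : ℕ} (f : L₂ (suc m) → L₂ n) (f-injective : InjectiveL f)
         (f-monotone : ∀ x y → x ≤L y → f x ≤L f y) where

  private
    ℓ : ℕ
    ℓ = lowMid (suc m)

  F : L₂ (suc m) → Subset n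
  F x = proj₁ (f x)

  Low Up : L₂ (suc m) → Set
  Low x = ∣ proj₁ x ∣ ≡ ℓ
  Up  x = ∣ proj₁ x ∣ ≡ suc ℓ

  low : (p : Subset (suc m)) → ∣ p ∣ ≡ ℓ → L₂ (suc m)
  low p ∣p∣≡ℓ = p , inj₁ ∣p∣≡ℓ

  up : (p : Subset (suc m)) → ∣ p ∣ ≡ suc ℓ → L₂ (suc m)
  up p ∣p∣≡ℓ+1 = p , inj₂ (trans ∣p∣≡ℓ+1 (sym (highMid-suc m)))

  Low⊎Up : ∀ x → Low x ⊎ Up x
  Low⊎Up (_ , inj₁ ∣p∣≡ℓ)  = inj₁ ∣p∣≡ℓ
  Low⊎Up (_ , inj₂ ∣p∣≡hi) = inj₂ (trans ∣p∣≡hi (highMid-suc m))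

  F-mono-≡ : ∀ x y → proj₁ x ≡ proj₁ y → F x ⊆ F y
  F-mono-≡ x y = f-monotone x y ∘ ⊆-reflexive

  insert-up : ∀ {w : Subset (suc m)} {i} → ∣ w ∣ ≡ ℓ → i ∉ w → ∣ w [ i ]≔ inside ∣ ≡ suc ℓ
  insert-up w-low i∉w = trans (∣p[i]≔inside∣ i∉w) (cong suc w-low)

  F-⊂-levels : ∀ x y → x ≤L y → proj₁ x ≢ proj₁ y →
               ∣ F x ∣ ≡ lowMid n × ∣ F y ∣ ≡ highMid n × highMid n ≡ suc (lowMid n)
  F-⊂-levels x y x≤y x≢y = middle-levels-< {n} (proj₂ (f x)) (proj₂ (f y))
    (p⊆q∧p≢q⇒∣p∣<∣q∣ (f-monotone x y x≤y) (x≢y ∘ f-injective x y))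

  F-low : ∀ x → Low x → ∣ F x ∣ ≡ lowMid n × highMid n ≡ suc (lowMid n)
  F-low x x-low with ∣p∣<n⇒∃∉ (subst (_< suc m) (sym x-low) (lowMid<suc m))
  ... | j , j∉x =
    let ∣Fx∣≡lo , _ , gap = F-⊂-levels x y ⊆-[]≔inside (∉∧∈⇒≢ j∉x ([]≔-updates _ j))
    in ∣Fx∣≡lo , gap
    where y = up (proj₁ x [ j ]≔ inside) (insert-up x-low j∉x)

  F-up : ∀ y → Up y → ∣ F y ∣ ≡ highMid n
  F-up y y-up with 0<∣p∣⇒∃∈ (subst (0 <_) (sym y-up) (s≤s z≤n))
  ... | j , j∈y = proj₁ (proj₂ (F-⊂-levels x y []≔outside-⊆ (∉∧∈⇒≢ i∉p[i]≔outside j∈y)))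
    where x = low (proj₁ y [ j ]≔ outside) (suc-injective (trans (∣p[i]≔outside∣ j∈y) y-up))

  ∣F-up∣≡suc∣F-low∣ : ∀ {x y} → Low x → Up y → ∣ F y ∣ ≡ suc ∣ F x ∣
  ∣F-up∣≡suc∣F-low∣ {x} {y} x-low y-up = begin
    ∣ F y ∣             ≡⟨ F-up y y-up ⟩
    highMid n           ≡⟨ proj₂ (F-low x x-low) ⟩
    suc (lowMid n)      ≡⟨ cong suc (proj₁ (F-low x x-low)) ⟨
    suc ∣ F x ∣         ∎
    where open ≡-Reasoning

  F-⊆-injective : ∀ x y → ∣ F x ∣ ≡ ∣ F y ∣ → F x ⊆ F y → proj₁ x ≡ proj₁ y
  F-⊆-injective x y ∣Fx∣≡∣Fy∣ Fx⊆Fy = f-injective x y (p⊆q∧∣p∣≡∣q∣⇒p≡q Fx⊆Fy ∣Fx∣≡∣Fy∣)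

  module LabelledEdge (a b : L₂ (suc m)) (a-low : Low a) (b-up : Up b) (a≤b : a ≤L b)
                      {e : Fin n} (e∉Fa : e ∉ F a) (e∈Fb : e ∈ F b) where

    Fb≡Fa[e]≔inside : F b ≡ F a [ e ]≔ inside
    Fb≡Fa[e]≔inside = cover⇒[]≔inside (f-monotone a b a≤b) (∣F-up∣≡suc∣F-low∣ a-low b-up) e∉Fa e∈Fb

    below : ∀ c → Low c → F c ⊆ F b → e ∉ F c → proj₁ c ≡ proj₁ a
    below c c-low Fc⊆Fb e∉Fc = F-⊆-injective c a
      (trans (proj₁ (F-low c c-low)) (sym (proj₁ (F-low a a-low))))
      (⊆-[]≔inside⁻ (subst (F c ⊆_) Fb≡Fa[e]≔inside Fc⊆Fb) e∉Fc)

    above : ∀ c → Up c → F a ⊆ F c → e ∈ F c → proj₁ b ≡ proj₁ c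
    above c c-up Fa⊆Fc e∈Fc = F-⊆-injective b c
      (trans (F-up b b-up) (sym (F-up c c-up)))
      (subst (_⊆ F c) (sym Fb≡Fa[e]≔inside) ([]≔inside-⊆ Fa⊆Fc e∈Fc))

  module _ (e : Fin n) (j : Fin (suc m)) where

    -- e labels the edge w ⊂ w ∪ {j}; stated for all representatives in L₂ of the
    -- two sets, as an element of L₂ also carries a proof of its level.
    Labels : Subset (suc m) → Set
    Labels w = ∀ a b → proj₁ a ≡ w → proj₁ b ≡ w [ j ]≔ inside → e ∉ F a × e ∈ F b

    Labels-swap : ∀ {v p q} → ∣ v ∣ ≡ ℓ → j ∉ v → p ∈ v → q ∉ v → q ≢ j →
                  Labels v → Labels (v [ p ]≔ outside [ q ]≔ inside)
    Labels-swap {v} {p} {q} v-low j∉v p∈v q∉v q≢j v-labels a′ b′ a′≡ b′≡ = e∉Fa′ , e∈Fb′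
      where
      v-p = v [ p ]≔ outside
      A = low v v-low
      P = up (v [ j ]≔ inside) (insert-up v-low j∉v)
      V-low = trans (∣p[i]≔outside[j]≔inside∣ p∈v j∉v) v-low
      V = low (v-p [ j ]≔ inside) V-low
      U = up (v [ q ]≔ inside) (insert-up v-low q∉v)
      labels-AP = v-labels A P refl refl
      module AP = LabelledEdge A P v-low (insert-up v-low j∉v) ⊆-[]≔inside
                               (proj₁ labels-AP) (proj₂ labels-AP)

      e∈FV : e ∈ F V
      e∈FV = decidable-stable (e ∈? F V) λ e∉FV → ∉∧∈⇒≢ j∉v ([]≔-updates v-p j)
        (sym (AP.below V V-low (f-monotone V P ([]≔-mono []≔outside-⊆)) e∉FV))

      e∈Fb′ : e ∈ F b′
      e∈Fb′ = f-monotone V b′ (⊆-trans ([]≔-mono ⊆-[]≔inside) (⊆-reflexive (sym b′≡))) e∈FV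

      e∉Fa′ : e ∉ F a′
      e∉Fa′ e∈Fa′ = ∉∧∈⇒≢ (∉-[]≔ (q≢j ∘ sym) j∉v) ([]≔-updates v j) (sym P≡U)
        where
        a′≤U : a′ ≤L U
        a′≤U = ⊆-trans (⊆-reflexive a′≡) ([]≔-mono []≔outside-⊆)
        P≡U : v [ j ]≔ inside ≡ v [ q ]≔ inside
        P≡U = AP.above U (insert-up v-low q∉v) (f-monotone A U ⊆-[]≔inside)
                         (f-monotone a′ U a′≤U e∈Fa′)

    Labels-propagate : ∀ {x} → ∣ x ∣ ≡ ℓ → j ∉ x →
                       ∀ {w} → Acc _<_ ∣ w ─ x ∣ → ∣ w ∣ ≡ ℓ → j ∉ w → Labels w → Labels x
    Labels-propagate {x} x-low j∉x {w} (acc rec) w-low j∉w w-labels with ⊆⊎∃∈∉ w x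
    ... | inj₁ w⊆x = subst Labels (p⊆q∧∣p∣≡∣q∣⇒p≡q w⊆x (trans w-low (sym x-low))) w-labels
    ... | inj₂ (p , p∈w , p∉x) with ⊆⊎∃∈∉ x w
    ...   | inj₁ x⊆w =
      contradiction (subst (p ∈_) (sym (p⊆q∧∣p∣≡∣q∣⇒p≡q x⊆w (trans x-low (sym w-low)))) p∈w) p∉x
    ...   | inj₂ (q , q∈x , q∉w) =
      Labels-propagate x-low j∉x (rec closer) w′-low j∉w′ (Labels-swap w-low j∉w p∈w q∉w q≢j w-labels)
      where
      w′ = w [ p ]≔ outside [ q ]≔ inside
      q≢j = ∈∧∉⇒≢ q∈x j∉x
      w′-low = trans (∣p[i]≔outside[j]≔inside∣ p∈w q∉w) w-low
      j∉w′ = ∉-[]≔ (q≢j ∘ sym) (∉-[]≔ (∈∧∉⇒≢ p∈w j∉w ∘ sym) j∉w)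
      closer : ∣ w′ ─ x ∣ < ∣ w ─ x ∣
      closer = ≤-reflexive (trans (cong suc (∣p[i]≔inside─q∣ {p = w [ p ]≔ outside} q∈x))
                                  (∣p[i]≔outside─q∣ p∈w p∉x))

  F-reflects-⊆-low-up : ∀ x y → Low x → Up y → F x ⊆ F y → x ≤L y
  F-reflects-⊆-low-up x y x-low y-up Fx⊆Fy
    with j , j∈y , j∉x ← ∣p∣<∣q∣⇒∃∈∉ {p = proj₁ x} {q = proj₁ y}
                           (≤-reflexive (trans (cong suc x-low) (sym y-up))) =
    ⊆-trans (⊆-reflexive (WY.below x x-low Fx⊆Fy e∉Fx)) []≔outside-⊆
    where
    W-low : ∣ proj₁ y [ j ]≔ outside ∣ ≡ ℓ
    W-low = suc-injective (trans (∣p[i]≔outside∣ j∈y) y-up)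
    W = low (proj₁ y [ j ]≔ outside) W-low
    e-witness = ∣p∣<∣q∣⇒∃∈∉ {p = F W} {q = F y} (≤-reflexive (sym (∣F-up∣≡suc∣F-low∣ W-low y-up)))
    e = proj₁ e-witness
    e∈Fy = proj₁ (proj₂ e-witness)
    e∉FW = proj₂ (proj₂ e-witness)
    module WY = LabelledEdge W y W-low y-up []≔outside-⊆ e∉FW e∈Fy
    W-labels : Labels e j (proj₁ W)
    W-labels a b a≡W b≡y = e∉FW ∘ F-mono-≡ a W a≡W
                         , F-mono-≡ y b (sym (trans b≡y ([]≔outside-[]≔inside j∈y))) e∈Fy
    e∉Fx : e ∉ F x
    e∉Fx = proj₁ (Labels-propagate e j x-low j∉x (<-wellFounded _) W-low i∉p[i]≔outside W-labels
                    x (up (proj₁ x [ j ]≔ inside) (insert-up x-low j∉x)) refl refl)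

  F-reflects-⊆ : ∀ x y → F x ⊆ F y → x ≤L y
  F-reflects-⊆ x y Fx⊆Fy with Low⊎Up x | Low⊎Up y
  ... | inj₁ x-low | inj₂ y-up  = F-reflects-⊆-low-up x y x-low y-up Fx⊆Fy
  ... | inj₁ x-low | inj₁ y-low =
    ⊆-reflexive (F-⊆-injective x y (trans (proj₁ (F-low x x-low)) (sym (proj₁ (F-low y y-low)))) Fx⊆Fy)
  ... | inj₂ x-up  | inj₂ y-up  =
    ⊆-reflexive (F-⊆-injective x y (trans (F-up x x-up) (sym (F-up y y-up))) Fx⊆Fy)
  ... | inj₂ x-up  | inj₁ y-low =
    contradiction (p⊆q⇒∣p∣≤∣q∣ Fx⊆Fy) (<⇒≱ (≤-reflexive (sym (∣F-up∣≡suc∣F-low∣ y-low x-up))))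

corollary2 : (k n : ℕ) → (f : L₂ k → L₂ n) → WeakEmbedding f →
    ∀ x y → (f x ≤L f y → x ≤L y) × (x ≤L y → f x ≤L f y)
corollary2 zero    n f (_ , f-monotone) x y = (λ { _ {()} }) , f-monotone x y
corollary2 (suc m) n f (f-injective , f-monotone) x y =
  F-reflects-⊆ f f-injective f-monotone x y , f-monotone x y
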